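{- Let $(T,\eta,\mu)$ be a localisable monad on a symmetric monoidal category $\mathcal{C}$ with strength $\mathrm{st}$, and let $u\leq v$ be central idempotents. Then the functor $\mathcal{C}\|_{u\leq v}\colon\mathcal{C}|_u\to\mathcal{C}|_v$ is an oplax monad morphism from $T|_u$ to $T|_v$, with natural transformation $\psi\colon\mathcal{C}\|_{u\leq v}\circ T|_u\Rightarrow T|_v\circ\mathcal{C}\|_{u\leq v}$ given by $\psi_A=\mathrm{st}_{A,U}\colon T(A)\otimes U\to T(A\otimes U)$.
   Context: Let $\mathcal{C}$ be a symmetric monoidal category with unit $I$, unitors $\lambda,\rho$, associator $\alpha$ (coherence isomorphisms often suppressed). A central idempotent is a morphism $u\colon U\to I$ such that $\rho_U\circ(U\otimes u)=\lambda_U\circ(u\otimes U)\colon U\otimes U\to U$ and this morphism is invertible; $u\leq v$ means $u=v\circ m$ for some $m\colon U\to V$. $\mathcal{C}|_u$ is the category with the objects of $\mathcal{C}$, morphisms $A\to B$ being morphisms $A\otimes U\to B$ of $\mathcal{C}$, composition of $f\colon A\otimes U\to B$, $g\colon B\otimes U\to C$ given by $g\circ(f\otimes U)\circ(A\otimes U\otimes u)^{ -1}$, identity $A\otimes u$. For $u\leq v$, $\mathcal{C}\|_{u\leq v}\colon\mathcal{C}|_u\to\mathcal{C}|_v$ is $A\mapsto A\otimes U$, $f\mapsto(f\otimes U)\circ(A\otimes u\otimes U)^{ -1}\circ(A\otimes U\otimes v)$; it is left adjoint to $\mathcal{C}|_{u\leq v}\colon A\mapsto A$, $f\mapsto f\circ(A\otimes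 m)$. A monad $(T,\eta,\mu)$ on $\mathcal{C}$ is localisable when there are morphisms $\mathrm{st}_{A,U}\colon T(A)\otimes U\to T(A\otimes U)$ for each object $A$ and central idempotent $u$ with: $T(\rho_A)\circ\mathrm{st}_{A,I}=\rho_{T(A)}$; $T(\alpha_{A,U,V})\circ\mathrm{st}_{A,U\otimes V}=\mathrm{st}_{A\otimes U,V}\circ(\mathrm{st}_{A,U}\otimes V)\circ\alpha_{TA,U,V}$; $\eta_{A\otimes U}=\mathrm{st}_{A,U}\circ(\eta_A\otimes U)$; $\mu_{A\otimes U}\circ T(\mathrm{st}_{A,U})\circ\mathrm{st}_{T(A),U}=\mathrm{st}_{A,U}\circ(\mu_A\otimes U)$; $\mathrm{st}_{A,V}\circ(T(A)\otimes m)=T(A\otimes m)\circ\mathrm{st}_{A,U}$ whenever $u=v\circ m$; $\mathrm{st}_{B,U}\circ(T(f)\otimes U)=T(f\otimes U)\circ\mathrm{st}_{A,U}$ for all $f\colon A\to B$. $T|_u$ is the monad on $\mathcal{C}|_u$ with $T|_u(A)=T(A)$, $T|_u(f\colon A\otimes U\to B)=T(f)\circ\mathrm{st}_{A,U}$, unit $\eta_A\otimes u$, multiplication $\mu_A\otimes u$. An oplax monad morphism from a monad $(S,\eta^S,\mu^S)$ on $\mathcal{A}$ to a monad $(R,\eta^R,\mu^R)$ on $\mathcal{B}$ is a functor $F\colon\mathcal{A}\to\mathcal{B}$ with a natural transformation $\psi\colon F\circ S\Rightarrow R\circ F$ compatible with units and multiplications: $\psi\circ F\eta^S=\eta^R_F$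 and $\psi\circ F\mu^S=\mu^R_F\circ R\psi\circ\psi S$. -}

module Defs where

open import Level using (Level; _⊔_) renaming (suc to lsuc)
open import Data.Product using (Σ)
open import Relation.Binary.Core using (Rel)
open import Relation.Binary.Structures using (IsEquivalence)

record Category (o ℓ e : Level) : Set (lsuc (o ⊔ ℓ ⊔ e)) where
  infix  4 _≈_
  infixr 9 _∘_
  infix  4 _⇒_
  field
    Obj   : Set o
    _⇒_   : Obj → Obj → Set ℓ
    _≈_   : ∀ {A B} → Rel (A ⇒ B) e
    id    : ∀ {A} → A ⇒ A
    _∘_   : ∀ {A B C} → B ⇒ C → A ⇒ B → A ⇒ C
    equiv     : ∀ {A B} → IsEquivalence (_≈_ {A} {B})
    assoc     : ∀ {A B C D} {f : A ⇒ B} {g : B ⇒ C} {h : C ⇒ D} →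
                (h ∘ g) ∘ f ≈ h ∘ (g ∘ f)
    identityˡ : ∀ {A B} {f : A ⇒ B} → id ∘ f ≈ f
    identityʳ : ∀ {A B} {f : A ⇒ B} → f ∘ id ≈ f
    ∘-resp-≈  : ∀ {A B C} {f h : B ⇒ C} {g i : A ⇒ B} →
                f ≈ h → g ≈ i → f ∘ g ≈ h ∘ i

record SymmetricMonoidal {o ℓ e} (C : Category o ℓ e) : Set (o ⊔ ℓ ⊔ e) where
  open Category C
  infixr 10 _⊗₀_ _⊗₁_
  field
    _⊗₀_ : Obj → Obj → Obj
    _⊗₁_ : ∀ {A B X Y} → A ⇒ B → X ⇒ Y → A ⊗₀ X ⇒ B ⊗₀ Y
    ⊗-identity : ∀ {A X} → id {A} ⊗₁ id {X} ≈ id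
    ⊗-homomorphism : ∀ {A B C' X Y Z} {f : B ⇒ C'} {g : A ⇒ B} {h : Y ⇒ Z} {i : X ⇒ Y} →
                     (f ∘ g) ⊗₁ (h ∘ i) ≈ (f ⊗₁ h) ∘ (g ⊗₁ i)
    ⊗-resp-≈ : ∀ {A B X Y} {f g : A ⇒ B} {h i : X ⇒ Y} → f ≈ g → h ≈ i → f ⊗₁ h ≈ g ⊗₁ i

    unit : Obj

    unitorˡ⇒ : ∀ {A} → unit ⊗₀ A ⇒ A
    unitorˡ⇐ : ∀ {A} → A ⇒ unit ⊗₀ A
    unitorˡ-isoˡ : ∀ {A} → unitorˡ⇐ ∘ unitorˡ⇒ {A} ≈ id
    unitorˡ-isoʳ : ∀ {A} → unitorˡ⇒ ∘ unitorˡ⇐ {A} ≈ id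
    unitorˡ-natural : ∀ {A B} {f : A ⇒ B} → unitorˡ⇒ ∘ (id ⊗₁ f) ≈ f ∘ unitorˡ⇒

    unitorʳ⇒ : ∀ {A} → A ⊗₀ unit ⇒ A
    unitorʳ⇐ : ∀ {A} → A ⇒ A ⊗₀ unit
    unitorʳ-isoˡ : ∀ {A} → unitorʳ⇐ ∘ unitorʳ⇒ {A} ≈ id
    unitorʳ-isoʳ : ∀ {A} → unitorʳ⇒ ∘ unitorʳ⇐ {A} ≈ id
    unitorʳ-natural : ∀ {A B} {f : A ⇒ B} → unitorʳ⇒ ∘ (f ⊗₁ id) ≈ f ∘ unitorʳ⇒

    associator⇒ : ∀ {A B C'} → (A ⊗₀ B) ⊗₀ C' ⇒ A ⊗₀ (B ⊗₀ C')
    associator⇐ : ∀ {A B C'} → A ⊗₀ (B ⊗₀ C') ⇒ (A ⊗₀ B) ⊗₀ C'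
    associator-isoˡ : ∀ {A B C'} → associator⇐ ∘ associator⇒ {A} {B} {C'} ≈ id
    associator-isoʳ : ∀ {A B C'} → associator⇒ ∘ associator⇐ {A} {B} {C'} ≈ id
    associator-natural : ∀ {A B X Y Z W} {f : A ⇒ B} {g : X ⇒ Y} {h : Z ⇒ W} →
                         associator⇒ ∘ ((f ⊗₁ g) ⊗₁ h) ≈ (f ⊗₁ (g ⊗₁ h)) ∘ associator⇒

    braiding : ∀ {A B} → A ⊗₀ B ⇒ B ⊗₀ A
    braiding-natural : ∀ {A B X Y} {f : A ⇒ B} {g : X ⇒ Y} →
                       braiding ∘ (f ⊗₁ g) ≈ (g ⊗₁ f) ∘ braiding
    commutative : ∀ {A B} → braiding {B} {A} ∘ braiding {A} {B} ≈ id

    triangle : ∀ {A B} → (id {A} ⊗₁ unitorˡ⇒ {B}) ∘ associator⇒ ≈ unitorʳ⇒ ⊗₁ id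
    pentagon : ∀ {A B C' D} →
               (id {A} ⊗₁ associator⇒ {B} {C'} {D}) ∘ (associator⇒ ∘ (associator⇒ ⊗₁ id))
               ≈ associator⇒ ∘ associator⇒
    hexagon : ∀ {A B C'} →
              (id {B} ⊗₁ braiding {A} {C'}) ∘ (associator⇒ ∘ (braiding {A} {B} ⊗₁ id))
              ≈ associator⇒ ∘ (braiding {A} {B ⊗₀ C'} ∘ associator⇒)

record Monad {o ℓ e} (C : Category o ℓ e) : Set (o ⊔ ℓ ⊔ e) where
  open Category C
  field
    T₀ : Obj → Obj
    T₁ : ∀ {A B} → A ⇒ B → T₀ A ⇒ T₀ B
    T-identity : ∀ {A} → T₁ (id {A}) ≈ id
    T-homomorphism : ∀ {A B C'} {f : A ⇒ B} {g : B ⇒ C'} → T₁ (g ∘ f) ≈ T₁ g ∘ T₁ f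
    T-resp-≈ : ∀ {A B} {f g : A ⇒ B} → f ≈ g → T₁ f ≈ T₁ g
    η : ∀ A → A ⇒ T₀ A
    μ : ∀ A → T₀ (T₀ A) ⇒ T₀ A
    η-natural : ∀ {A B} (f : A ⇒ B) → η B ∘ f ≈ T₁ f ∘ η A
    μ-natural : ∀ {A B} (f : A ⇒ B) → μ B ∘ T₁ (T₁ f) ≈ T₁ f ∘ μ A
    identityˡ : ∀ {A} → μ A ∘ T₁ (η A) ≈ id
    identityʳ : ∀ {A} → μ A ∘ η (T₀ A) ≈ id
    assoc : ∀ {A} → μ A ∘ T₁ (μ A) ≈ μ A ∘ μ (T₀ A)

module _ {o ℓ e} {C : Category o ℓ e} (M : SymmetricMonoidal C) where
  open Category C
  open SymmetricMonoidal M

  record IsCentralIdempotent {U : Obj} (u : U ⇒ unit) : Set (ℓ ⊔ e) where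
    field
      central : unitorʳ⇒ ∘ (id ⊗₁ u) ≈ unitorˡ⇒ ∘ (u ⊗₁ id)
      inv     : U ⇒ U ⊗₀ U
      inv-isoˡ : inv ∘ (unitorʳ⇒ ∘ (id ⊗₁ u)) ≈ id
      inv-isoʳ : (unitorʳ⇒ ∘ (id ⊗₁ u)) ∘ inv ≈ id

  _≤CI_ : ∀ {U V} → U ⇒ unit → V ⇒ unit → Set (ℓ ⊔ e)
  _≤CI_ {U} {V} u v = Σ (U ⇒ V) (λ m → u ≈ v ∘ m)

  tensorCI : ∀ {U V} → U ⇒ unit → V ⇒ unit → U ⊗₀ V ⇒ unit
  tensorCI u v = unitorˡ⇒ ∘ (u ⊗₁ v)

  record Localisable (T : Monad C) : Set (o ⊔ ℓ ⊔ e) where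
    open Monad T
    field
      st : ∀ A {U} (u : U ⇒ unit) → IsCentralIdempotent u → T₀ A ⊗₀ U ⇒ T₀ (A ⊗₀ U)
      st-unit : ∀ A (p : IsCentralIdempotent (id {unit})) →
                T₁ (unitorʳ⇒ {A}) ∘ st A id p ≈ unitorʳ⇒
      st-assoc : ∀ A {U V} (u : U ⇒ unit) (p : IsCentralIdempotent u)
                 (v : V ⇒ unit) (q : IsCentralIdempotent v)
                 (r : IsCentralIdempotent (tensorCI u v)) →
                 T₁ (associator⇐ {A} {U} {V}) ∘ st A (tensorCI u v) r
                 ≈ st (A ⊗₀ U) v q ∘ ((st A u p ⊗₁ id) ∘ associator⇐)
      st-η : ∀ A {U} (u : U ⇒ unit) (p : IsCentralIdempotent u) →
             η (A ⊗₀ U) ≈ st A u p ∘ (η A ⊗₁ id)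
      st-μ : ∀ A {U} (u : U ⇒ unit) (p : IsCentralIdempotent u) →
             μ (A ⊗₀ U) ∘ (T₁ (st A u p) ∘ st (T₀ A) u p) ≈ st A u p ∘ (μ A ⊗₁ id)
      st-≤ : ∀ A {U V} (u : U ⇒ unit) (p : IsCentralIdempotent u)
             (v : V ⇒ unit) (q : IsCentralIdempotent v) (m : U ⇒ V) →
             u ≈ v ∘ m →
             st A v q ∘ (id ⊗₁ m) ≈ T₁ (id ⊗₁ m) ∘ st A u p
      st-natural : ∀ {A B} (f : A ⇒ B) {U} (u : U ⇒ unit) (p : IsCentralIdempotent u) →
                   st B u p ∘ (T₁ f ⊗₁ id) ≈ T₁ (f ⊗₁ id) ∘ st A u p

-- Raw categories / monads / functors (only the data), used for C|_u

record RawCategory (o ℓ e : Level) : Set (lsuc (o ⊔ ℓ ⊔ e)) where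
  infix  4 _≈_
  infixr 9 _∘_
  field
    Obj : Set o
    Hom : Obj → Obj → Set ℓ
    _≈_ : ∀ {A B} → Rel (Hom A B) e
    id  : ∀ {A} → Hom A A
    _∘_ : ∀ {A B C} → Hom B C → Hom A B → Hom A C

record RawMonad {o ℓ e} (C : RawCategory o ℓ e) : Set (o ⊔ ℓ) where
  open RawCategory C
  field
    T₀ : Obj → Obj
    T₁ : ∀ {A B} → Hom A B → Hom (T₀ A) (T₀ B)
    η  : ∀ A → Hom A (T₀ A)
    μ  : ∀ A → Hom (T₀ (T₀ A)) (T₀ A)

record RawFunctor {o ℓ e o' ℓ' e'} (C : RawCategory o ℓ e) (D : RawCategory o' ℓ' e')
       : Set (o ⊔ ℓ ⊔ o' ⊔ ℓ') where
  private
    module C = RawCategory C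
    module D = RawCategory D
  field
    F₀ : C.Obj → D.Obj
    F₁ : ∀ {A B} → C.Hom A B → D.Hom (F₀ A) (F₀ B)

record IsOplaxMonadMorphism {o ℓ e o' ℓ' e'}
       {𝒜 : RawCategory o ℓ e} {ℬ : RawCategory o' ℓ' e'}
       (S : RawMonad 𝒜) (R : RawMonad ℬ) (F : RawFunctor 𝒜 ℬ)
       (ψ : ∀ A → RawCategory.Hom ℬ (RawFunctor.F₀ F (RawMonad.T₀ S A))
                                     (RawMonad.T₀ R (RawFunctor.F₀ F A)))
       : Set (o ⊔ ℓ ⊔ e ⊔ ℓ' ⊔ e') where
  private
    module A = RawCategory 𝒜
    module S = RawMonad S
    module R = RawMonad R
  open RawCategory ℬ
  open RawFunctor F
  field
    F-resp-≈ : ∀ {X Y} {f g : A.Hom X Y} → f A.≈ g → F₁ f ≈ F₁ g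
    F-identity : ∀ {X} → F₁ (A.id {X}) ≈ id
    F-homomorphism : ∀ {X Y Z} (f : A.Hom X Y) (g : A.Hom Y Z) →
                     F₁ (g A.∘ f) ≈ F₁ g ∘ F₁ f
    ψ-natural : ∀ {X Y} (f : A.Hom X Y) →
                ψ Y ∘ F₁ (S.T₁ f) ≈ R.T₁ (F₁ f) ∘ ψ X
    ψ-unit : ∀ X → ψ X ∘ F₁ (S.η X) ≈ R.η (F₀ X)
    ψ-mult : ∀ X → ψ X ∘ F₁ (S.μ X) ≈ R.μ (F₀ X) ∘ (R.T₁ (ψ X) ∘ ψ (S.T₀ X))

module Restriction {o ℓ e} {C : Category o ℓ e} (M : SymmetricMonoidal C)
                   (T : Monad C) (L : Localisable M T) where
  open Category C
  open SymmetricMonoidal M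
  open Monad T
  open Localisable L

  module _ {U : Obj} (u : U ⇒ unit) (p : IsCentralIdempotent M u) where
    open IsCentralIdempotent p

    A⊗u : ∀ A → A ⊗₀ U ⇒ A
    A⊗u A = unitorʳ⇒ ∘ (id {A} ⊗₁ u)

    -- the inverse of  A ⊗ U ⊗ u = ρ_{A⊗U} ∘ ((A ⊗ U) ⊗ u) : (A⊗U)⊗U → A⊗U
    -- (equally the inverse of A ⊗ u ⊗ U), namely α⁻¹ ∘ (A ⊗ inv)
    δ : ∀ A → A ⊗₀ U ⇒ (A ⊗₀ U) ⊗₀ U
    δ A = associator⇐ ∘ (id {A} ⊗₁ inv)

    C∣ : RawCategory o ℓ e
    C∣ = record
      { Obj = Obj
      ; Hom = λ A B → A ⊗₀ U ⇒ B
      ; _≈_ = _≈_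
      ; id  = λ {A} → A⊗u A
      ; _∘_ = λ {A} g f → g ∘ ((f ⊗₁ id) ∘ δ A)
      }

    T∣ : RawMonad C∣
    T∣ = record
      { T₀ = T₀
      ; T₁ = λ {A} f → T₁ f ∘ st A u p
      ; η  = λ A → unitorʳ⇒ ∘ (η A ⊗₁ u)
      ; μ  = λ A → unitorʳ⇒ ∘ (μ A ⊗₁ u)
      }

  module _ {U V : Obj} (u : U ⇒ unit) (p : IsCentralIdempotent M u)
           (v : V ⇒ unit) (q : IsCentralIdempotent M v) where

    -- the functor C‖_{u≤v} : C|_u → C|_v
    -- f ↦ (f ⊗ U) ∘ (A ⊗ u ⊗ U)⁻¹ ∘ (A ⊗ U ⊗ v)
    C‖ : RawFunctor (C∣ u p) (C∣ v q)
    C‖ = record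
      { F₀ = λ A → A ⊗₀ U
      ; F₁ = λ {A} f → (f ⊗₁ id) ∘ (δ u p A ∘ A⊗u v q (A ⊗₀ U))
      }

    -- ψ_A = st_{A,U}, viewed as a morphism of C|_v (i.e. precomposed
    -- with X ⊗ v, the image of st_{A,U} under C → C|_v)
    ψ : ∀ A → (T₀ A ⊗₀ U) ⊗₀ V ⇒ T₀ (A ⊗₀ U)
    ψ A = st A u p ∘ A⊗u v q (T₀ A ⊗₀ U)

{-# OPTIONS --safe #-}
-- The functor C‖_{u≤v} factors as the extension C|_u → C, f ↦ (f ⊗ U) ∘ δ, where δ is the
-- inverse of A ⊗ u ⊗ U, followed by J : C → C|_v, g ↦ g ∘ (A ⊗ v). Both are functors, and J
-- sends T, η, μ to T|_v, η|_v, μ|_v (T(A ⊗ v) ∘ st_{A,V} = T(A) ⊗ v, because v ≤ id and the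
-- strength along id is the unitor). Since ψ = J(st), every oplax law is J applied to an
-- equation in C: naturality of st along the extension, resp. the unit and multiplication
-- axioms of st.

module Submission where

open import Defs
open import Level using (Level)
open import Relation.Binary.Bundles using (Setoid)
open import Relation.Binary.Structures using (IsEquivalence)
import Relation.Binary.Reasoning.Setoid as SetoidReasoning

module MonoidalProperties {o ℓ e} {C : Category o ℓ e} (M : SymmetricMonoidal C) where
  open Category C public
  open SymmetricMonoidal M public

  module Equiv {A B : Obj} = IsEquivalence (equiv {A} {B})

  hom-setoid : Obj → Obj → Setoid ℓ e
  hom-setoid A B = record { Carrier = A ⇒ B ; _≈_ = _≈_ ; isEquivalence = equiv }

  module HomReasoning {A B : Obj} where
    open SetoidReasoning (hom-setoid A B) public

  open HomReasoning public

  infixr 4 _⟩∘⟨_ _⟩⊗⟨_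
  _⟩∘⟨_ : ∀ {A B D} {f h : B ⇒ D} {g i : A ⇒ B} → f ≈ h → g ≈ i → f ∘ g ≈ h ∘ i
  _⟩∘⟨_ = ∘-resp-≈

  _⟩⊗⟨_ : ∀ {A B X Y} {f g : A ⇒ B} {h i : X ⇒ Y} → f ≈ g → h ≈ i → f ⊗₁ h ≈ g ⊗₁ i
  _⟩⊗⟨_ = ⊗-resp-≈

  sym-assoc : ∀ {A B D E} {f : A ⇒ B} {g : B ⇒ D} {h : D ⇒ E} → h ∘ (g ∘ f) ≈ (h ∘ g) ∘ f
  sym-assoc = Equiv.sym assoc

  split₁ : ∀ {A B D X} {f : B ⇒ D} {g : A ⇒ B} → (f ∘ g) ⊗₁ id {X} ≈ (f ⊗₁ id) ∘ (g ⊗₁ id)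
  split₁ = Equiv.trans (Equiv.refl ⟩⊗⟨ Equiv.sym identityˡ) ⊗-homomorphism

  split₂ : ∀ {A B D X} {f : B ⇒ D} {g : A ⇒ B} → id {X} ⊗₁ (f ∘ g) ≈ (id ⊗₁ f) ∘ (id ⊗₁ g)
  split₂ = Equiv.trans (Equiv.sym identityˡ ⟩⊗⟨ Equiv.refl) ⊗-homomorphism

  cancelInner : ∀ {A B D E} {f : D ⇒ E} {h : B ⇒ D} {i : D ⇒ B} {g : A ⇒ D} →
                h ∘ i ≈ id → (f ∘ h) ∘ (i ∘ g) ≈ f ∘ g
  cancelInner {f = f} {h} {i} {g} hi≈id = begin
    (f ∘ h) ∘ (i ∘ g) ≈⟨ assoc ⟩
    f ∘ (h ∘ (i ∘ g)) ≈⟨ Equiv.refl ⟩∘⟨ sym-assoc ⟩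
    f ∘ ((h ∘ i) ∘ g) ≈⟨ Equiv.refl ⟩∘⟨ hi≈id ⟩∘⟨ Equiv.refl ⟩
    f ∘ (id ∘ g)      ≈⟨ Equiv.refl ⟩∘⟨ identityˡ ⟩
    f ∘ g             ∎

  inverse-unique : ∀ {A B} {q p : B ⇒ A} {n : A ⇒ B} → q ∘ n ≈ id → n ∘ p ≈ id → q ≈ p
  inverse-unique {q = q} {p} {n} qn≈id np≈id = begin
    q            ≈⟨ Equiv.sym identityʳ ⟩
    q ∘ id       ≈⟨ Equiv.refl ⟩∘⟨ Equiv.sym np≈id ⟩
    q ∘ (n ∘ p)  ≈⟨ sym-assoc ⟩
    (q ∘ n) ∘ p  ≈⟨ qn≈id ⟩∘⟨ Equiv.refl ⟩
    id ∘ p       ≈⟨ identityˡ ⟩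
    p            ∎

  transpose-inverses : ∀ {A B A′ B′} {m : A ⇒ B} {i : B ⇒ A} {m′ : A′ ⇒ B′} {i′ : B′ ⇒ A′}
                       {a : A ⇒ A′} {b : B ⇒ B′} →
                       m ∘ i ≈ id → i′ ∘ m′ ≈ id → m′ ∘ a ≈ b ∘ m → i′ ∘ b ≈ a ∘ i
  transpose-inverses {m = m} {i} {m′} {i′} {a} {b} mi≈id i′m′≈id square = begin
    i′ ∘ b               ≈⟨ Equiv.sym identityʳ ⟩
    (i′ ∘ b) ∘ id        ≈⟨ Equiv.refl ⟩∘⟨ Equiv.sym mi≈id ⟩
    (i′ ∘ b) ∘ (m ∘ i)   ≈⟨ assoc ⟩
    i′ ∘ (b ∘ (m ∘ i))   ≈⟨ Equiv.refl ⟩∘⟨ sym-assoc ⟩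
    i′ ∘ ((b ∘ m) ∘ i)   ≈⟨ Equiv.refl ⟩∘⟨ Equiv.sym square ⟩∘⟨ Equiv.refl ⟩
    i′ ∘ ((m′ ∘ a) ∘ i)  ≈⟨ Equiv.refl ⟩∘⟨ assoc ⟩
    i′ ∘ (m′ ∘ (a ∘ i))  ≈⟨ sym-assoc ⟩
    (i′ ∘ m′) ∘ (a ∘ i)  ≈⟨ i′m′≈id ⟩∘⟨ Equiv.refl ⟩
    id ∘ (a ∘ i)         ≈⟨ identityˡ ⟩
    a ∘ i                ∎

  split-epi-cancel : ∀ {A B D} {f g : B ⇒ D} {w : A ⇒ B} {w⁻ : B ⇒ A} →
                     w ∘ w⁻ ≈ id → f ∘ w ≈ g ∘ w → f ≈ g
  split-epi-cancel {f = f} {g} {w} {w⁻} ww⁻≈id fw≈gw = begin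
    f              ≈⟨ Equiv.sym identityʳ ⟩
    f ∘ id         ≈⟨ Equiv.refl ⟩∘⟨ Equiv.sym ww⁻≈id ⟩
    f ∘ (w ∘ w⁻)   ≈⟨ sym-assoc ⟩
    (f ∘ w) ∘ w⁻   ≈⟨ fw≈gw ⟩∘⟨ Equiv.refl ⟩
    (g ∘ w) ∘ w⁻   ≈⟨ assoc ⟩
    g ∘ (w ∘ w⁻)   ≈⟨ Equiv.refl ⟩∘⟨ ww⁻≈id ⟩
    g ∘ id         ≈⟨ identityʳ ⟩
    g              ∎

  unitorˡ-conjugate : ∀ {A B} {f : A ⇒ B} → f ≈ unitorˡ⇒ ∘ ((id ⊗₁ f) ∘ unitorˡ⇐)
  unitorˡ-conjugate {f = f} = begin
    f                                 ≈⟨ Equiv.sym identityʳ ⟩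
    f ∘ id                            ≈⟨ Equiv.refl ⟩∘⟨ Equiv.sym unitorˡ-isoʳ ⟩
    f ∘ (unitorˡ⇒ ∘ unitorˡ⇐)         ≈⟨ sym-assoc ⟩
    (f ∘ unitorˡ⇒) ∘ unitorˡ⇐         ≈⟨ Equiv.sym unitorˡ-natural ⟩∘⟨ Equiv.refl ⟩
    (unitorˡ⇒ ∘ (id ⊗₁ f)) ∘ unitorˡ⇐ ≈⟨ assoc ⟩
    unitorˡ⇒ ∘ ((id ⊗₁ f) ∘ unitorˡ⇐) ∎

  unitorʳ-conjugate : ∀ {A B} {f : A ⇒ B} → f ≈ unitorʳ⇒ ∘ ((f ⊗₁ id) ∘ unitorʳ⇐)
  unitorʳ-conjugate {f = f} = begin
    f                                 ≈⟨ Equiv.sym identityʳ ⟩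
    f ∘ id                            ≈⟨ Equiv.refl ⟩∘⟨ Equiv.sym unitorʳ-isoʳ ⟩
    f ∘ (unitorʳ⇒ ∘ unitorʳ⇐)         ≈⟨ sym-assoc ⟩
    (f ∘ unitorʳ⇒) ∘ unitorʳ⇐         ≈⟨ Equiv.sym unitorʳ-natural ⟩∘⟨ Equiv.refl ⟩
    (unitorʳ⇒ ∘ (f ⊗₁ id)) ∘ unitorʳ⇐ ≈⟨ assoc ⟩
    unitorʳ⇒ ∘ ((f ⊗₁ id) ∘ unitorʳ⇐) ∎

  unit⊗-injective : ∀ {A B} {f g : A ⇒ B} → id {unit} ⊗₁ f ≈ id ⊗₁ g → f ≈ g
  unit⊗-injective eq =
    Equiv.trans unitorˡ-conjugate
      (Equiv.trans (Equiv.refl ⟩∘⟨ eq ⟩∘⟨ Equiv.refl) (Equiv.sym unitorˡ-conjugate))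

  ⊗unit-injective : ∀ {A B} {f g : A ⇒ B} → f ⊗₁ id {unit} ≈ g ⊗₁ id → f ≈ g
  ⊗unit-injective eq =
    Equiv.trans unitorʳ-conjugate
      (Equiv.trans (Equiv.refl ⟩∘⟨ eq ⟩∘⟨ Equiv.refl) (Equiv.sym unitorʳ-conjugate))

  -- Kelly's lemmas: both follow from the pentagon and the triangle axiom alone.
  unitorˡ-associator : ∀ {X Y} → unitorˡ⇒ {X ⊗₀ Y} ∘ associator⇒ ≈ unitorˡ⇒ ⊗₁ id
  unitorˡ-associator {X} {Y} =
    unit⊗-injective (split-epi-cancel pentagon-path-iso
      (Equiv.trans via-associator (Equiv.sym via-unitor)))
    where
    pentagon-path : ((unit ⊗₀ unit) ⊗₀ X) ⊗₀ Y ⇒ unit ⊗₀ ((unit ⊗₀ X) ⊗₀ Y)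
    pentagon-path = associator⇒ ∘ (associator⇒ ⊗₁ id)

    pentagon-path-iso : pentagon-path ∘ ((associator⇐ ⊗₁ id) ∘ associator⇐) ≈ id
    pentagon-path-iso = begin
      (associator⇒ ∘ (associator⇒ ⊗₁ id)) ∘ ((associator⇐ ⊗₁ id) ∘ associator⇐)
        ≈⟨ cancelInner (Equiv.trans (Equiv.sym split₁)
                         (Equiv.trans (associator-isoʳ ⟩⊗⟨ Equiv.refl) ⊗-identity)) ⟩
      associator⇒ ∘ associator⇐ ≈⟨ associator-isoʳ ⟩
      id                        ∎

    via-associator : (id ⊗₁ (unitorˡ⇒ ∘ associator⇒)) ∘ pentagon-path
                     ≈ associator⇒ ∘ ((unitorʳ⇒ ⊗₁ id) ⊗₁ id)
    via-associator = begin
      (id ⊗₁ (unitorˡ⇒ ∘ associator⇒)) ∘ pentagon-path          ≈⟨ split₂ ⟩∘⟨ Equiv.refl ⟩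
      ((id ⊗₁ unitorˡ⇒) ∘ (id ⊗₁ associator⇒)) ∘ pentagon-path  ≈⟨ assoc ⟩
      (id ⊗₁ unitorˡ⇒) ∘ ((id ⊗₁ associator⇒) ∘ pentagon-path)  ≈⟨ Equiv.refl ⟩∘⟨ pentagon ⟩
      (id ⊗₁ unitorˡ⇒) ∘ (associator⇒ ∘ associator⇒)            ≈⟨ sym-assoc ⟩
      ((id ⊗₁ unitorˡ⇒) ∘ associator⇒) ∘ associator⇒            ≈⟨ triangle ⟩∘⟨ Equiv.refl ⟩
      (unitorʳ⇒ ⊗₁ id) ∘ associator⇒              ≈⟨ (Equiv.refl ⟩⊗⟨ Equiv.sym ⊗-identity) ⟩∘⟨ Equiv.refl ⟩
      (unitorʳ⇒ ⊗₁ (id ⊗₁ id)) ∘ associator⇒      ≈⟨ Equiv.sym associator-natural ⟩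
      associator⇒ ∘ ((unitorʳ⇒ ⊗₁ id) ⊗₁ id)      ∎

    via-unitor : (id ⊗₁ (unitorˡ⇒ ⊗₁ id)) ∘ pentagon-path ≈ associator⇒ ∘ ((unitorʳ⇒ ⊗₁ id) ⊗₁ id)
    via-unitor = begin
      (id ⊗₁ (unitorˡ⇒ ⊗₁ id)) ∘ (associator⇒ ∘ (associator⇒ ⊗₁ id))   ≈⟨ sym-assoc ⟩
      ((id ⊗₁ (unitorˡ⇒ ⊗₁ id)) ∘ associator⇒) ∘ (associator⇒ ⊗₁ id)
        ≈⟨ Equiv.sym associator-natural ⟩∘⟨ Equiv.refl ⟩
      (associator⇒ ∘ ((id ⊗₁ unitorˡ⇒) ⊗₁ id)) ∘ (associator⇒ ⊗₁ id)   ≈⟨ assoc ⟩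
      associator⇒ ∘ (((id ⊗₁ unitorˡ⇒) ⊗₁ id) ∘ (associator⇒ ⊗₁ id))   ≈⟨ Equiv.refl ⟩∘⟨ Equiv.sym split₁ ⟩
      associator⇒ ∘ (((id ⊗₁ unitorˡ⇒) ∘ associator⇒) ⊗₁ id)  ≈⟨ Equiv.refl ⟩∘⟨ triangle ⟩⊗⟨ Equiv.refl ⟩
      associator⇒ ∘ ((unitorʳ⇒ ⊗₁ id) ⊗₁ id)                   ∎

  unitorˡ≈unitorʳ : unitorˡ⇒ {unit} ≈ unitorʳ⇒
  unitorˡ≈unitorʳ = Equiv.sym (⊗unit-injective (begin
    unitorʳ⇒ ⊗₁ id                  ≈⟨ Equiv.sym triangle ⟩
    (id ⊗₁ unitorˡ⇒) ∘ associator⇒  ≈⟨ Equiv.sym unitorˡ-id⊗ ⟩∘⟨ Equiv.refl ⟩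
    unitorˡ⇒ ∘ associator⇒          ≈⟨ unitorˡ-associator ⟩
    unitorˡ⇒ ⊗₁ id                  ∎))
    where
    unitorˡ-id⊗ : unitorˡ⇒ {unit ⊗₀ unit} ≈ id ⊗₁ unitorˡ⇒
    unitorˡ-id⊗ = begin
      unitorˡ⇒                                           ≈⟨ Equiv.sym identityˡ ⟩
      id ∘ unitorˡ⇒                                      ≈⟨ Equiv.sym unitorˡ-isoˡ ⟩∘⟨ Equiv.refl ⟩
      (unitorˡ⇐ ∘ unitorˡ⇒) ∘ unitorˡ⇒                   ≈⟨ assoc ⟩
      unitorˡ⇐ ∘ (unitorˡ⇒ ∘ unitorˡ⇒)                   ≈⟨ Equiv.refl ⟩∘⟨ Equiv.sym unitorˡ-natural ⟩
      unitorˡ⇐ ∘ (unitorˡ⇒ ∘ (id ⊗₁ unitorˡ⇒))           ≈⟨ sym-assoc ⟩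
      (unitorˡ⇐ ∘ unitorˡ⇒) ∘ (id ⊗₁ unitorˡ⇒)           ≈⟨ unitorˡ-isoˡ ⟩∘⟨ Equiv.refl ⟩
      id ∘ (id ⊗₁ unitorˡ⇒)                              ≈⟨ identityˡ ⟩
      id ⊗₁ unitorˡ⇒                                     ∎

module CentralIdempotentProperties {o ℓ e} {C : Category o ℓ e} (M : SymmetricMonoidal C)
       {W : Category.Obj C} (w : Category._⇒_ C W (SymmetricMonoidal.unit M))
       (pw : IsCentralIdempotent M w) where
  open MonoidalProperties M
  open IsCentralIdempotent pw

  ε : ∀ X → X ⊗₀ W ⇒ X
  ε X = unitorʳ⇒ ∘ (id {X} ⊗₁ w)

  δ : ∀ X → X ⊗₀ W ⇒ (X ⊗₀ W) ⊗₀ W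
  δ X = associator⇐ ∘ (id {X} ⊗₁ inv)

  -- ε X is A ⊗ w of the paper; _∘ʷ_ is composition in C|_w.
  infixr 9 _∘ʷ_
  _∘ʷ_ : ∀ {X Y Z} → Y ⊗₀ W ⇒ Z → X ⊗₀ W ⇒ Y → X ⊗₀ W ⇒ Z
  _∘ʷ_ {X} g f = g ∘ ((f ⊗₁ id) ∘ δ X)

  J : ∀ {X Y} → X ⇒ Y → X ⊗₀ W ⇒ Y
  J {X} f = f ∘ ε X

  extend : ∀ {X Y} → X ⊗₀ W ⇒ Y → X ⊗₀ W ⇒ Y ⊗₀ W
  extend {X} f = (f ⊗₁ id) ∘ δ X

  ∘ʷ-resp-≈ : ∀ {X Y Z} {g g′ : Y ⊗₀ W ⇒ Z} {f f′ : X ⊗₀ W ⇒ Y} →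
              g ≈ g′ → f ≈ f′ → g ∘ʷ f ≈ g′ ∘ʷ f′
  ∘ʷ-resp-≈ g≈g′ f≈f′ = g≈g′ ⟩∘⟨ (f≈f′ ⟩⊗⟨ Equiv.refl) ⟩∘⟨ Equiv.refl

  unitorʳ-⊗w : ∀ {X Y} (f : X ⇒ Y) → unitorʳ⇒ ∘ (f ⊗₁ w) ≈ J f
  unitorʳ-⊗w f = begin
    unitorʳ⇒ ∘ (f ⊗₁ w)                ≈⟨ Equiv.refl ⟩∘⟨ (Equiv.sym identityʳ ⟩⊗⟨ Equiv.sym identityˡ) ⟩
    unitorʳ⇒ ∘ ((f ∘ id) ⊗₁ (id ∘ w))  ≈⟨ Equiv.refl ⟩∘⟨ ⊗-homomorphism ⟩
    unitorʳ⇒ ∘ ((f ⊗₁ id) ∘ (id ⊗₁ w)) ≈⟨ sym-assoc ⟩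
    (unitorʳ⇒ ∘ (f ⊗₁ id)) ∘ (id ⊗₁ w) ≈⟨ unitorʳ-natural ⟩∘⟨ Equiv.refl ⟩
    (f ∘ unitorʳ⇒) ∘ (id ⊗₁ w)         ≈⟨ assoc ⟩
    f ∘ ε _                            ∎

  ε-natural : ∀ {X Y} (f : X ⇒ Y) → ε Y ∘ (f ⊗₁ id) ≈ f ∘ ε X
  ε-natural f = begin
    (unitorʳ⇒ ∘ (id ⊗₁ w)) ∘ (f ⊗₁ id) ≈⟨ assoc ⟩
    unitorʳ⇒ ∘ ((id ⊗₁ w) ∘ (f ⊗₁ id)) ≈⟨ Equiv.refl ⟩∘⟨ Equiv.sym ⊗-homomorphism ⟩
    unitorʳ⇒ ∘ ((id ∘ f) ⊗₁ (w ∘ id))  ≈⟨ Equiv.refl ⟩∘⟨ (identityˡ ⟩⊗⟨ identityʳ) ⟩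
    unitorʳ⇒ ∘ (f ⊗₁ w)                ≈⟨ unitorʳ-⊗w f ⟩
    f ∘ ε _                            ∎

  -- Centrality moves the idempotent from the first to the second factor of W ⊗ W.
  ε⊗id≈id⊗ε∘associator : ∀ X → ε X ⊗₁ id ≈ (id ⊗₁ ε W) ∘ associator⇒
  ε⊗id≈id⊗ε∘associator X = begin
    (unitorʳ⇒ ∘ (id ⊗₁ w)) ⊗₁ id                         ≈⟨ split₁ ⟩
    (unitorʳ⇒ ⊗₁ id) ∘ ((id ⊗₁ w) ⊗₁ id)                 ≈⟨ Equiv.sym triangle ⟩∘⟨ Equiv.refl ⟩
    ((id ⊗₁ unitorˡ⇒) ∘ associator⇒) ∘ ((id ⊗₁ w) ⊗₁ id) ≈⟨ assoc ⟩
    (id ⊗₁ unitorˡ⇒) ∘ (associator⇒ ∘ ((id ⊗₁ w) ⊗₁ id)) ≈⟨ Equiv.refl ⟩∘⟨ associator-natural ⟩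
    (id ⊗₁ unitorˡ⇒) ∘ ((id ⊗₁ (w ⊗₁ id)) ∘ associator⇒) ≈⟨ sym-assoc ⟩
    ((id ⊗₁ unitorˡ⇒) ∘ (id ⊗₁ (w ⊗₁ id))) ∘ associator⇒ ≈⟨ Equiv.sym split₂ ⟩∘⟨ Equiv.refl ⟩
    (id ⊗₁ (unitorˡ⇒ ∘ (w ⊗₁ id))) ∘ associator⇒         ≈⟨ (Equiv.refl ⟩⊗⟨ Equiv.sym central) ⟩∘⟨ Equiv.refl ⟩
    (id ⊗₁ ε W) ∘ associator⇒                            ∎

  δ-isoʳ : ∀ X → (ε X ⊗₁ id) ∘ δ X ≈ id
  δ-isoʳ X = begin
    (ε X ⊗₁ id) ∘ δ X                                       ≈⟨ ε⊗id≈id⊗ε∘associator X ⟩∘⟨ Equiv.refl ⟩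
    ((id ⊗₁ ε W) ∘ associator⇒) ∘ (associator⇐ ∘ (id ⊗₁ inv)) ≈⟨ cancelInner associator-isoʳ ⟩
    (id ⊗₁ ε W) ∘ (id ⊗₁ inv)                               ≈⟨ Equiv.sym split₂ ⟩
    id ⊗₁ (ε W ∘ inv)                                       ≈⟨ Equiv.refl ⟩⊗⟨ inv-isoʳ ⟩
    id ⊗₁ id                                                ≈⟨ ⊗-identity ⟩
    id                                                      ∎

  δ-isoˡ : ∀ X → δ X ∘ (ε X ⊗₁ id) ≈ id
  δ-isoˡ X = begin
    δ X ∘ (ε X ⊗₁ id)                                         ≈⟨ Equiv.refl ⟩∘⟨ ε⊗id≈id⊗ε∘associator X ⟩
    (associator⇐ ∘ (id ⊗₁ inv)) ∘ ((id ⊗₁ ε W) ∘ associator⇒)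
      ≈⟨ cancelInner (Equiv.trans (Equiv.sym split₂)
                       (Equiv.trans (Equiv.refl ⟩⊗⟨ inv-isoˡ) ⊗-identity)) ⟩
    associator⇐ ∘ associator⇒                                 ≈⟨ associator-isoˡ ⟩
    id                                                        ∎

  ε⊗id-natural : ∀ {X Y} (f : X ⇒ Y) → (ε Y ⊗₁ id {W}) ∘ ((f ⊗₁ id) ⊗₁ id) ≈ (f ⊗₁ id) ∘ (ε X ⊗₁ id)
  ε⊗id-natural f = Equiv.trans (Equiv.sym split₁)
                     (Equiv.trans (ε-natural f ⟩⊗⟨ Equiv.refl) split₁)

  δ-natural : ∀ {X Y} (f : X ⇒ Y) → δ Y ∘ (f ⊗₁ id) ≈ ((f ⊗₁ id) ⊗₁ id) ∘ δ X
  δ-natural {X} {Y} f = transpose-inverses (δ-isoʳ X) (δ-isoˡ Y) (ε⊗id-natural f)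

  δ-coassoc : ∀ X → δ (X ⊗₀ W) ∘ δ X ≈ (δ X ⊗₁ id) ∘ δ X
  δ-coassoc X = Equiv.sym (inverse-unique left-inverse right-inverse)
    where
    ε² : ((X ⊗₀ W) ⊗₀ W) ⊗₀ W ⇒ X ⊗₀ W
    ε² = (ε X ⊗₁ id) ∘ (ε (X ⊗₀ W) ⊗₁ id)

    right-inverse : ε² ∘ (δ (X ⊗₀ W) ∘ δ X) ≈ id
    right-inverse = Equiv.trans (cancelInner (δ-isoʳ (X ⊗₀ W))) (δ-isoʳ X)

    left-inverse : ((δ X ⊗₁ id) ∘ δ X) ∘ ε² ≈ id
    left-inverse = begin
      ((δ X ⊗₁ id) ∘ δ X) ∘ ε²                                  ≈⟨ Equiv.refl ⟩∘⟨ Equiv.sym split₁ ⟩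
      ((δ X ⊗₁ id) ∘ δ X) ∘ ((ε X ∘ ε (X ⊗₀ W)) ⊗₁ id)
        ≈⟨ Equiv.refl ⟩∘⟨ Equiv.sym (ε-natural (ε X)) ⟩⊗⟨ Equiv.refl ⟩
      ((δ X ⊗₁ id) ∘ δ X) ∘ ((ε X ∘ (ε X ⊗₁ id)) ⊗₁ id)         ≈⟨ Equiv.refl ⟩∘⟨ split₁ ⟩
      ((δ X ⊗₁ id) ∘ δ X) ∘ ((ε X ⊗₁ id) ∘ ((ε X ⊗₁ id) ⊗₁ id)) ≈⟨ cancelInner (δ-isoˡ X) ⟩
      (δ X ⊗₁ id) ∘ ((ε X ⊗₁ id) ⊗₁ id)                          ≈⟨ Equiv.sym split₁ ⟩
      (δ X ∘ (ε X ⊗₁ id)) ⊗₁ id                                  ≈⟨ δ-isoˡ X ⟩⊗⟨ Equiv.refl ⟩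
      id ⊗₁ id                                                   ≈⟨ ⊗-identity ⟩
      id                                                         ∎

  extend-∘ : ∀ {X Y Z} (g : Y ⇒ Z) (f : X ⊗₀ W ⇒ Y) → extend (g ∘ f) ≈ (g ⊗₁ id) ∘ extend f
  extend-∘ g f = Equiv.trans (split₁ ⟩∘⟨ Equiv.refl) assoc

  extend-J : ∀ {X Y} (f : X ⇒ Y) → extend (J f) ≈ f ⊗₁ id
  extend-J {X} f = begin
    extend (f ∘ ε X)               ≈⟨ extend-∘ f (ε X) ⟩
    (f ⊗₁ id) ∘ extend (ε X)       ≈⟨ Equiv.refl ⟩∘⟨ δ-isoʳ X ⟩
    (f ⊗₁ id) ∘ id                 ≈⟨ identityʳ ⟩
    f ⊗₁ id                        ∎

  extend-unitorʳ : ∀ {X Y} (f : X ⇒ Y) → extend (unitorʳ⇒ ∘ (f ⊗₁ w)) ≈ f ⊗₁ id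
  extend-unitorʳ f = Equiv.trans ((unitorʳ-⊗w f ⟩⊗⟨ Equiv.refl) ⟩∘⟨ Equiv.refl) (extend-J f)

  extend-homomorphism : ∀ {X Y Z} (f : X ⊗₀ W ⇒ Y) (g : Y ⊗₀ W ⇒ Z) →
                        extend (g ∘ʷ f) ≈ extend g ∘ extend f
  extend-homomorphism {X} {Y} f g = begin
    extend (g ∘ extend f)                              ≈⟨ extend-∘ g (extend f) ⟩
    (g ⊗₁ id) ∘ extend (extend f)                      ≈⟨ Equiv.refl ⟩∘⟨ extend-∘ (f ⊗₁ id) (δ X) ⟩
    (g ⊗₁ id) ∘ (((f ⊗₁ id) ⊗₁ id) ∘ extend (δ X))     ≈⟨ Equiv.refl ⟩∘⟨ Equiv.refl ⟩∘⟨ Equiv.sym (δ-coassoc X) ⟩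
    (g ⊗₁ id) ∘ (((f ⊗₁ id) ⊗₁ id) ∘ (δ (X ⊗₀ W) ∘ δ X)) ≈⟨ Equiv.refl ⟩∘⟨ sym-assoc ⟩
    (g ⊗₁ id) ∘ ((((f ⊗₁ id) ⊗₁ id) ∘ δ (X ⊗₀ W)) ∘ δ X) ≈⟨ Equiv.refl ⟩∘⟨ Equiv.sym (δ-natural f) ⟩∘⟨ Equiv.refl ⟩
    (g ⊗₁ id) ∘ ((δ Y ∘ (f ⊗₁ id)) ∘ δ X)              ≈⟨ Equiv.refl ⟩∘⟨ assoc ⟩
    (g ⊗₁ id) ∘ (δ Y ∘ extend f)                       ≈⟨ sym-assoc ⟩
    extend g ∘ extend f                                ∎

  J-homomorphism : ∀ {X Y Z} (g : Y ⇒ Z) (f : X ⇒ Y) → J g ∘ʷ J f ≈ J (g ∘ f)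
  J-homomorphism {X} g f = begin
    (g ∘ ε _) ∘ extend (f ∘ ε X)          ≈⟨ Equiv.refl ⟩∘⟨ extend-J f ⟩
    (g ∘ ε _) ∘ (f ⊗₁ id)                 ≈⟨ assoc ⟩
    g ∘ (ε _ ∘ (f ⊗₁ id))                 ≈⟨ Equiv.refl ⟩∘⟨ ε-natural f ⟩
    g ∘ (f ∘ ε X)                         ≈⟨ sym-assoc ⟩
    (g ∘ f) ∘ ε X                         ∎

module LocalisableProperties {o ℓ e} {C : Category o ℓ e} (M : SymmetricMonoidal C)
       (T : Monad C) (L : Localisable M T) where
  open MonoidalProperties M
  open Monad T using (T₀; T₁; T-identity; T-homomorphism; T-resp-≈)
  open Localisable L using (st; st-unit; st-≤; st-natural)

  id-isCentralIdempotent : IsCentralIdempotent M (id {unit})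
  id-isCentralIdempotent = record
    { central  = begin
        unitorʳ⇒ ∘ (id ⊗₁ id) ≈⟨ Equiv.refl ⟩∘⟨ ⊗-identity ⟩
        unitorʳ⇒ ∘ id         ≈⟨ identityʳ ⟩
        unitorʳ⇒              ≈⟨ Equiv.sym unitorˡ≈unitorʳ ⟩
        unitorˡ⇒              ≈⟨ Equiv.sym identityʳ ⟩
        unitorˡ⇒ ∘ id         ≈⟨ Equiv.refl ⟩∘⟨ Equiv.sym ⊗-identity ⟩
        unitorˡ⇒ ∘ (id ⊗₁ id) ∎
    ; inv      = unitorʳ⇐
    ; inv-isoˡ = Equiv.trans (Equiv.refl ⟩∘⟨ unitorʳ∘id⊗id) unitorʳ-isoˡ
    ; inv-isoʳ = Equiv.trans (unitorʳ∘id⊗id ⟩∘⟨ Equiv.refl) unitorʳ-isoʳ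
    }
    where
    unitorʳ∘id⊗id : unitorʳ⇒ ∘ (id ⊗₁ id) ≈ unitorʳ⇒ {unit}
    unitorʳ∘id⊗id = Equiv.trans (Equiv.refl ⟩∘⟨ ⊗-identity) identityʳ

  T-inverse : ∀ {A B} {f : B ⇒ A} {g : A ⇒ B} → f ∘ g ≈ id → T₁ f ∘ T₁ g ≈ id
  T-inverse fg≈id = Equiv.trans (Equiv.sym T-homomorphism)
                      (Equiv.trans (T-resp-≈ fg≈id) T-identity)

  module _ {W : Obj} (w : W ⇒ unit) (pw : IsCentralIdempotent M w) where
    open CentralIdempotentProperties M w pw

    -- w ≤ id (as w = id ∘ w), so st-≤ reduces the strength along w to the one along id.
    st-ε : ∀ X → T₁ (ε X) ∘ st X w pw ≈ ε (T₀ X)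
    st-ε X = begin
      T₁ (unitorʳ⇒ ∘ (id ⊗₁ w)) ∘ st X w pw       ≈⟨ T-homomorphism ⟩∘⟨ Equiv.refl ⟩
      (T₁ unitorʳ⇒ ∘ T₁ (id ⊗₁ w)) ∘ st X w pw    ≈⟨ assoc ⟩
      T₁ unitorʳ⇒ ∘ (T₁ (id ⊗₁ w) ∘ st X w pw)
        ≈⟨ Equiv.refl ⟩∘⟨ Equiv.sym (st-≤ X w pw id id-isCentralIdempotent w (Equiv.sym identityˡ)) ⟩
      T₁ unitorʳ⇒ ∘ (st X id id-isCentralIdempotent ∘ (id ⊗₁ w)) ≈⟨ sym-assoc ⟩
      (T₁ unitorʳ⇒ ∘ st X id id-isCentralIdempotent) ∘ (id ⊗₁ w)
        ≈⟨ st-unit X id-isCentralIdempotent ⟩∘⟨ Equiv.refl ⟩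
      unitorʳ⇒ ∘ (id ⊗₁ w)                        ∎

    T-J : ∀ {X Y} (f : X ⇒ Y) → T₁ (J f) ∘ st X w pw ≈ J (T₁ f)
    T-J {X} f = begin
      T₁ (f ∘ ε X) ∘ st X w pw          ≈⟨ T-homomorphism ⟩∘⟨ Equiv.refl ⟩
      (T₁ f ∘ T₁ (ε X)) ∘ st X w pw     ≈⟨ assoc ⟩
      T₁ f ∘ (T₁ (ε X) ∘ st X w pw)     ≈⟨ Equiv.refl ⟩∘⟨ st-ε X ⟩
      T₁ f ∘ ε (T₀ X)                   ∎

    st-δ : ∀ X → st (X ⊗₀ W) w pw ∘ extend (st X w pw) ≈ T₁ (δ X) ∘ st X w pw
    st-δ X = Equiv.sym (Equiv.trans (transpose-inverses (δ-isoʳ (T₀ X)) (T-inverse (δ-isoˡ X)) square) assoc)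
      where
      s = st X w pw
      square : T₁ (ε X ⊗₁ id) ∘ (st (X ⊗₀ W) w pw ∘ (s ⊗₁ id)) ≈ s ∘ (ε (T₀ X) ⊗₁ id)
      square = Equiv.sym (begin
        s ∘ (ε (T₀ X) ⊗₁ id)                           ≈⟨ Equiv.refl ⟩∘⟨ Equiv.sym (st-ε X) ⟩⊗⟨ Equiv.refl ⟩
        s ∘ ((T₁ (ε X) ∘ s) ⊗₁ id)                     ≈⟨ Equiv.refl ⟩∘⟨ split₁ ⟩
        s ∘ ((T₁ (ε X) ⊗₁ id) ∘ (s ⊗₁ id))             ≈⟨ sym-assoc ⟩
        (s ∘ (T₁ (ε X) ⊗₁ id)) ∘ (s ⊗₁ id)             ≈⟨ st-natural (ε X) w pw ⟩∘⟨ Equiv.refl ⟩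
        (T₁ (ε X ⊗₁ id) ∘ st (X ⊗₀ W) w pw) ∘ (s ⊗₁ id) ≈⟨ assoc ⟩
        T₁ (ε X ⊗₁ id) ∘ (st (X ⊗₀ W) w pw ∘ (s ⊗₁ id)) ∎)

    st-extend : ∀ {X Y} (f : X ⊗₀ W ⇒ Y) →
                st Y w pw ∘ extend (T₁ f ∘ st X w pw) ≈ T₁ (extend f) ∘ st X w pw
    st-extend {X} {Y} f = begin
      st Y w pw ∘ extend (T₁ f ∘ s)                        ≈⟨ Equiv.refl ⟩∘⟨ extend-∘ (T₁ f) s ⟩
      st Y w pw ∘ ((T₁ f ⊗₁ id) ∘ extend s)                ≈⟨ sym-assoc ⟩
      (st Y w pw ∘ (T₁ f ⊗₁ id)) ∘ extend s                ≈⟨ st-natural f w pw ⟩∘⟨ Equiv.refl ⟩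
      (T₁ (f ⊗₁ id) ∘ st (X ⊗₀ W) w pw) ∘ extend s         ≈⟨ assoc ⟩
      T₁ (f ⊗₁ id) ∘ (st (X ⊗₀ W) w pw ∘ extend s)         ≈⟨ Equiv.refl ⟩∘⟨ st-δ X ⟩
      T₁ (f ⊗₁ id) ∘ (T₁ (δ X) ∘ s)                        ≈⟨ sym-assoc ⟩
      (T₁ (f ⊗₁ id) ∘ T₁ (δ X)) ∘ s                        ≈⟨ Equiv.sym T-homomorphism ⟩∘⟨ Equiv.refl ⟩
      T₁ (extend f) ∘ s                                    ∎
      where s = st X w pw

module RestrictionFunctorProperties {o ℓ e} {C : Category o ℓ e} (M : SymmetricMonoidal C)
       (T : Monad C) (L : Localisable M T) {U V : Category.Obj C}
       (u : Category._⇒_ C U (SymmetricMonoidal.unit M)) (p : IsCentralIdempotent M u)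
       (v : Category._⇒_ C V (SymmetricMonoidal.unit M)) (q : IsCentralIdempotent M v) where
  open MonoidalProperties M
  open Monad T using (T₀; T₁; T-resp-≈; η; μ)
  open Localisable L using (st; st-η; st-μ)
  open LocalisableProperties M T L using (T-J; st-extend)
  module Cᵘ = CentralIdempotentProperties M u p
  module Cᵛ = CentralIdempotentProperties M v q
  open Cᵛ using (J; _∘ʷ_; ∘ʷ-resp-≈; J-homomorphism; unitorʳ-⊗w)

  C‖₁ : ∀ {X Y} → X ⊗₀ U ⇒ Y → (X ⊗₀ U) ⊗₀ V ⇒ Y ⊗₀ U
  C‖₁ = RawFunctor.F₁ (Restriction.C‖ M T L u p v q)

  ψ : ∀ X → (T₀ X ⊗₀ U) ⊗₀ V ⇒ T₀ (X ⊗₀ U)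
  ψ = Restriction.ψ M T L u p v q

  C‖₁≈J∘extend : ∀ {X Y} (f : X ⊗₀ U ⇒ Y) → C‖₁ f ≈ J (Cᵘ.extend f)
  C‖₁≈J∘extend f = sym-assoc

  C‖-resp-≈ : ∀ {X Y} {f g : X ⊗₀ U ⇒ Y} → f ≈ g → C‖₁ f ≈ C‖₁ g
  C‖-resp-≈ f≈g = (f≈g ⟩⊗⟨ Equiv.refl) ⟩∘⟨ Equiv.refl

  C‖-identity : ∀ {X} → C‖₁ (Cᵘ.ε X) ≈ Cᵛ.ε (X ⊗₀ U)
  C‖-identity {X} = begin
    C‖₁ (Cᵘ.ε X)              ≈⟨ C‖₁≈J∘extend (Cᵘ.ε X) ⟩
    J (Cᵘ.extend (Cᵘ.ε X))    ≈⟨ Cᵘ.δ-isoʳ X ⟩∘⟨ Equiv.refl ⟩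
    J id                      ≈⟨ identityˡ ⟩
    Cᵛ.ε (X ⊗₀ U)             ∎

  C‖-homomorphism : ∀ {X Y Z} (f : X ⊗₀ U ⇒ Y) (g : Y ⊗₀ U ⇒ Z) →
                    C‖₁ (g Cᵘ.∘ʷ f) ≈ C‖₁ g ∘ʷ C‖₁ f
  C‖-homomorphism f g = begin
    C‖₁ (g Cᵘ.∘ʷ f)                          ≈⟨ C‖₁≈J∘extend (g Cᵘ.∘ʷ f) ⟩
    J (Cᵘ.extend (g Cᵘ.∘ʷ f))                ≈⟨ Cᵘ.extend-homomorphism f g ⟩∘⟨ Equiv.refl ⟩
    J (Cᵘ.extend g ∘ Cᵘ.extend f)            ≈⟨ Equiv.sym (J-homomorphism (Cᵘ.extend g) (Cᵘ.extend f)) ⟩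
    J (Cᵘ.extend g) ∘ʷ J (Cᵘ.extend f)
      ≈⟨ Equiv.sym (∘ʷ-resp-≈ (C‖₁≈J∘extend g) (C‖₁≈J∘extend f)) ⟩
    C‖₁ g ∘ʷ C‖₁ f                           ∎

  ψ-∘ʷ-C‖₁ : ∀ {X Y} (f : X ⊗₀ U ⇒ T₀ Y) → ψ Y ∘ʷ C‖₁ f ≈ J (st Y u p ∘ Cᵘ.extend f)
  ψ-∘ʷ-C‖₁ {Y = Y} f = Equiv.trans (∘ʷ-resp-≈ Equiv.refl (C‖₁≈J∘extend f))
                                    (J-homomorphism (st Y u p) (Cᵘ.extend f))

  ψ-natural : ∀ {X Y} (f : X ⊗₀ U ⇒ Y) →
              ψ Y ∘ʷ C‖₁ (T₁ f ∘ st X u p) ≈ (T₁ (C‖₁ f) ∘ st (X ⊗₀ U) v q) ∘ʷ ψ X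
  ψ-natural {X} f = begin
    ψ _ ∘ʷ C‖₁ (T₁ f ∘ st X u p)                         ≈⟨ ψ-∘ʷ-C‖₁ (T₁ f ∘ st X u p) ⟩
    J (st _ u p ∘ Cᵘ.extend (T₁ f ∘ st X u p))           ≈⟨ st-extend u p f ⟩∘⟨ Equiv.refl ⟩
    J (T₁ (Cᵘ.extend f) ∘ st X u p)                      ≈⟨ Equiv.sym (J-homomorphism _ _) ⟩
    J (T₁ (Cᵘ.extend f)) ∘ʷ ψ X                          ≈⟨ ∘ʷ-resp-≈ (Equiv.sym (T-J v q (Cᵘ.extend f))) Equiv.refl ⟩
    (T₁ (J (Cᵘ.extend f)) ∘ st (X ⊗₀ U) v q) ∘ʷ ψ X
      ≈⟨ ∘ʷ-resp-≈ (T-resp-≈ (Equiv.sym (C‖₁≈J∘extend f)) ⟩∘⟨ Equiv.refl) Equiv.refl ⟩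
    (T₁ (C‖₁ f) ∘ st (X ⊗₀ U) v q) ∘ʷ ψ X                ∎

  ψ-unit : ∀ X → ψ X ∘ʷ C‖₁ (unitorʳ⇒ ∘ (η X ⊗₁ u)) ≈ unitorʳ⇒ ∘ (η (X ⊗₀ U) ⊗₁ v)
  ψ-unit X = begin
    ψ X ∘ʷ C‖₁ (unitorʳ⇒ ∘ (η X ⊗₁ u))                  ≈⟨ ψ-∘ʷ-C‖₁ _ ⟩
    J (st X u p ∘ Cᵘ.extend (unitorʳ⇒ ∘ (η X ⊗₁ u)))    ≈⟨ (Equiv.refl ⟩∘⟨ Cᵘ.extend-unitorʳ (η X)) ⟩∘⟨ Equiv.refl ⟩
    J (st X u p ∘ (η X ⊗₁ id))                          ≈⟨ Equiv.sym (st-η X u p) ⟩∘⟨ Equiv.refl ⟩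
    J (η (X ⊗₀ U))                                      ≈⟨ Equiv.sym (unitorʳ-⊗w (η (X ⊗₀ U))) ⟩
    unitorʳ⇒ ∘ (η (X ⊗₀ U) ⊗₁ v)                        ∎

  ψ-mult : ∀ X → ψ X ∘ʷ C‖₁ (unitorʳ⇒ ∘ (μ X ⊗₁ u))
                 ≈ (unitorʳ⇒ ∘ (μ (X ⊗₀ U) ⊗₁ v)) ∘ʷ
                   ((T₁ (ψ X) ∘ st (T₀ X ⊗₀ U) v q) ∘ʷ ψ (T₀ X))
  ψ-mult X = begin
    ψ X ∘ʷ C‖₁ (unitorʳ⇒ ∘ (μ X ⊗₁ u))                  ≈⟨ ψ-∘ʷ-C‖₁ _ ⟩
    J (st X u p ∘ Cᵘ.extend (unitorʳ⇒ ∘ (μ X ⊗₁ u)))    ≈⟨ (Equiv.refl ⟩∘⟨ Cᵘ.extend-unitorʳ (μ X)) ⟩∘⟨ Equiv.refl ⟩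
    J (st X u p ∘ (μ X ⊗₁ id))                          ≈⟨ Equiv.sym (st-μ X u p) ⟩∘⟨ Equiv.refl ⟩
    J (μ (X ⊗₀ U) ∘ (T₁ (st X u p) ∘ st (T₀ X) u p))    ≈⟨ Equiv.sym (J-homomorphism _ _) ⟩
    J (μ (X ⊗₀ U)) ∘ʷ J (T₁ (st X u p) ∘ st (T₀ X) u p) ≈⟨ ∘ʷ-resp-≈ Equiv.refl (Equiv.sym (J-homomorphism _ _)) ⟩
    J (μ (X ⊗₀ U)) ∘ʷ (J (T₁ (st X u p)) ∘ʷ ψ (T₀ X))
      ≈⟨ ∘ʷ-resp-≈ (Equiv.sym (unitorʳ-⊗w (μ (X ⊗₀ U))))
                   (∘ʷ-resp-≈ (Equiv.sym (T-J v q (st X u p))) Equiv.refl) ⟩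
    (unitorʳ⇒ ∘ (μ (X ⊗₀ U) ⊗₁ v)) ∘ʷ ((T₁ (ψ X) ∘ st (T₀ X ⊗₀ U) v q) ∘ʷ ψ (T₀ X)) ∎

corollary3p8 : ∀ {o ℓ e : Level} {C : Category o ℓ e} (M : SymmetricMonoidal C)
                 (T : Monad C) (L : Localisable M T)
                 {U V : Category.Obj C}
                 (u : Category._⇒_ C U (SymmetricMonoidal.unit M)) (p : IsCentralIdempotent M u)
                 (v : Category._⇒_ C V (SymmetricMonoidal.unit M)) (q : IsCentralIdempotent M v) →
                 _≤CI_ M u v →
                 IsOplaxMonadMorphism (Restriction.T∣ M T L u p) (Restriction.T∣ M T L v q)
                   (Restriction.C‖ M T L u p v q) (Restriction.ψ M T L u p v q)
corollary3p8 M T L u p v q _ = record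
  { F-resp-≈       = C‖-resp-≈
  ; F-identity     = C‖-identity
  ; F-homomorphism = C‖-homomorphism
  ; ψ-natural      = ψ-natural
  ; ψ-unit         = ψ-unit
  ; ψ-mult         = ψ-mult
  }
  where open RestrictionFunctorProperties M T L u p v q
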